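{- Let $n\ge1$ and let $H\subseteq\mathrm{CCP}_{2n}$ be a group under composition. If $D^h$ is a path for every $h\in H$ and every $D\in\mathcal{D}_n$, then $\{h(\cdot):h\in H\}$ is a subgroup of the symmetric group on $\mathcal{D}_n$ (a group of order-$\mathrm{Cat}_n$-set permutations, $S_{\mathrm{Cat}_n}$) under composition of maps.
   Context: A Dyck path of size $n$ is a word in $\mathtt{u},\mathtt{d}$ with $n$ of each letter whose every prefix has at least as many $\mathtt{u}$'s as $\mathtt{d}$'s; $\mathcal{D}_n$ is their set, of cardinality $\mathrm{Cat}_n=\frac{1}{n+1}\binom{2n}{n}$. The tunneling $\tau_D\in S_{2n}$ of $D$ is the fixed-point-free involution pairing each up-step position with the position of its matching down-step. For $\sigma\in S_{2n}$, $\sigma_k=\sigma(k)$, $\sigma_{[k]}=\{\sigma_1,\dots,\sigma_k\}$; $\sigma(D)$ is the word with $\sigma(D)_k=\mathtt{u}$ if $\tau_D(\sigma_k)\notin\sigma_{[k]}$, $\mathtt{d}$ otherwise, and $\sigma(\cdot)$ is the map $D\mapsto\sigma(D)$ on $\mathcal{D}_n$. A block of size $k$ is a set of $k$ cyclically consecutive elements of $[2n]$ (mod $2n$); $\sigma$ is a CCP if $\sigma_{[k]}$ is a block of size $k$ for every $k$; $\mathrm{CCP}_{2n}$ is the set of CCPs. For $\sigma\in S_{2n}$, $D^\sigma$ denotes the pairing of $[2n]$ with tunneling $\tau_{D^\sigma}$ given by $\tau_{D^\sigma}(\sigma(k))=\sigma(\tau_D(k))$; $D^\sigma$ is a path if $\tau_{D^\sigma}=\tau_P$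 for some $P\in\mathcal{D}_n$. -}

module Defs where

open import Data.Nat using (ℕ; zero; suc; _+_; _*_; _≤_; _<_)
open import Data.Nat.Properties using (_≟_; _<?_; _≤?_)
open import Data.Fin using (Fin; toℕ)
open import Data.Fin.Properties using (any?; all?) renaming (_≟_ to _≟F_)
open import Data.Fin.Permutation using (Permutation′; _⟨$⟩ʳ_)
open import Data.Vec using (Vec; []; _∷_; lookup; tabulate)
open import Data.Product using (Σ; ∃; _×_; _,_)
open import Data.Sum using (_⊎_)
open import Data.Bool using (if_then_else_)
open import Function.Bundles using (_⇔_)
open import Relation.Nullary using (Dec; yes; no; ¬_; does)
open import Relation.Nullary.Decidable using (_×-dec_; _⊎-dec_; _→-dec_; ¬?)
open import Relation.Binary.PropositionalEquality using (_≡_; refl)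

data Step : Set where
  u d : Step

_≟S_ : (x y : Step) → Dec (x ≡ y)
u ≟S u = yes refl
u ≟S d = no λ ()
d ≟S u = no λ ()
d ≟S d = yes refl

isU isD : Step → ℕ
isU u = 1
isU d = 0
isD u = 0
isD d = 1

ups downs : ∀ {m} → Vec Step m → ℕ → ℕ
ups []       k       = 0
ups (x ∷ xs) zero    = 0
ups (x ∷ xs) (suc k) = isU x + ups xs k
downs []       k       = 0
downs (x ∷ xs) zero    = 0
downs (x ∷ xs) (suc k) = isD x + downs xs k

Dyck : (n : ℕ) → Vec Step (2 * n) → Set
Dyck n w = ups w (2 * n) ≡ n × downs w (2 * n) ≡ n × (∀ k → downs w k ≤ ups w k)

-- Positions are 0-indexed (Fin m).  Matched w i j : the
-- up-step at position i is matched with the down-step at position j,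
-- i.e. j is the first position after i at which the path returns to the
-- height it had before step i.  (Height after a prefix of length k is
-- ups w k - downs w k; we compare in ℕ by cross-adding.)

Matched : ∀ {m} → Vec Step m → Fin m → Fin m → Set
Matched {m} w i j =
  toℕ i < toℕ j × lookup w i ≡ u × lookup w j ≡ d
  × ups w (suc (toℕ j)) + downs w (toℕ i) ≡ downs w (suc (toℕ j)) + ups w (toℕ i)
  × (∀ (k : Fin m) → toℕ i < toℕ k → toℕ k ≤ toℕ j →
       downs w (toℕ k) + ups w (toℕ i) < ups w (toℕ k) + downs w (toℕ i))

Matched? : ∀ {m} (w : Vec Step m) i j → Dec (Matched w i j)
Matched? w i j =
  (toℕ i <? toℕ j) ×-dec (lookup w i ≟S u) ×-dec (lookup w j ≟S d)
  ×-dec (ups w (suc (toℕ j)) + downs w (toℕ i) ≟ downs w (suc (toℕ j)) + ups w (toℕ i))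
  ×-dec all? (λ k → (toℕ i <? toℕ k) →-dec (toℕ k ≤? toℕ j) →-dec
       (downs w (toℕ k) + ups w (toℕ i) <? ups w (toℕ k) + downs w (toℕ i)))

-- The graph of the tunneling involution τ_w :  Tun w a b  means  τ_w(a) = b.
Tun : ∀ {m} → Vec Step m → Fin m → Fin m → Set
Tun w a b = Matched w a b ⊎ Matched w b a

Tun? : ∀ {m} (w : Vec Step m) a b → Dec (Tun w a b)
Tun? w a b = Matched? w a b ⊎-dec Matched? w b a

-- x ∈ σ_[k] = {σ(0),…,σ(k-1)}  (0-indexed version of {σ_1,…,σ_k})
InPre : ∀ {m} → Permutation′ m → ℕ → Fin m → Set
InPre σ k x = ∃ λ l → toℕ l < k × σ ⟨$⟩ʳ l ≡ x

InPre? : ∀ {m} (σ : Permutation′ m) k x → Dec (InPre σ k x)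
InPre? σ k x = any? (λ l → (toℕ l <? k) ×-dec (σ ⟨$⟩ʳ l ≟F x))

-- σ(D)_k = u  iff  τ_D(σ_k) ∉ σ_[k]  (the prefix σ_1..σ_k, i.e. the
-- 0-indexed prefix of length k+1), and d otherwise.
act : ∀ {m} → Permutation′ m → Vec Step m → Vec Step m
act σ w = tabulate λ k →
  if does (any? λ j → Tun? w (σ ⟨$⟩ʳ k) j ×-dec ¬? (InPre? σ (suc (toℕ k)) j))
  then u else d

Block : (m : ℕ) → Fin m → ℕ → Fin m → Set
Block m a k x = ∃ λ i → i < k × (toℕ a + i ≡ toℕ x ⊎ toℕ a + i ≡ toℕ x + m)

IsBlockOfSize : (m : ℕ) → (Fin m → Set) → ℕ → Set
IsBlockOfSize m S k = ∃ λ (a : Fin m) → ∀ x → S x ⇔ Block m a k x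

IsCCP : ∀ {m} → Permutation′ m → Set
IsCCP {m} σ = ∀ k → 1 ≤ k → k ≤ m → IsBlockOfSize m (InPre σ k) k

-- D^σ is a path: there is a Dyck path P with τ_P(σ(k)) = σ(τ_D(k)).

IsPathTwist : (n : ℕ) → Permutation′ (2 * n) → Vec Step (2 * n) → Set
IsPathTwist n σ D = ∃ λ P → Dyck n P × (∀ k j → Tun P (σ ⟨$⟩ʳ k) (σ ⟨$⟩ʳ j) ⇔ Tun D k j)

-- Write τ_D for the tunneling of D. If the twisted pairing D^{h⁻¹} is the tunneling of a
-- Dyck path P, then h(D) = P: reading h(1), h(2), … in order, the letter at step k is u
-- exactly when the partner τ_D(h(k)) has not been read yet, i.e. when k is the smaller end
-- of its arc in τ_P = h⁻¹ τ_D h. Since every up step of a Dyck path is the smaller end of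
-- an arc, h(·) is the map D ↦ D^{h⁻¹}, and D ↦ D^g is a right action of H on 𝒟_n.
module Submission where

open import Defs
open import Data.Nat using (ℕ; suc; _+_; _*_; _≤_; _<_; _≤‴_; ≤‴-refl; ≤‴-step; s≤s)
open import Data.Nat.Properties
  using (_<?_; ≤-refl; ≤-reflexive; ≤-antisym; <⇒≤; <⇒≱; ≤⇒≯; ≮⇒≥; ≤⇒≤‴; ≤‴⇒≤; m<n⇒m<1+n;
         m≤n⇒m<n∨m≡n; +-comm; +-monoʳ-≤; +-commutativeSemigroup)
open import Algebra.Properties.CommutativeSemigroup +-commutativeSemigroup using (x∙yz≈y∙xz)
open import Data.Fin using (Fin; zero; suc; toℕ; fromℕ<)
open import Data.Fin.Properties using (any?; toℕ<n; toℕ-fromℕ<)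
open import Data.Fin.Permutation using (Permutation′; _⟨$⟩ʳ_; _⟨$⟩ˡ_; inverseʳ)
open import Data.Vec using (Vec; []; _∷_; lookup)
open import Data.Vec.Properties using (tabulate-cong; tabulate∘lookup)
open import Data.Product using (∃; _×_; _,_; proj₁)
open import Data.Sum using (inj₁; inj₂)
open import Data.Empty using (⊥-elim)
open import Data.Bool using (if_then_else_)
open import Function.Bundles using (_⇔_; Equivalence; Injection)
open import Function.Construct.Identity using (⇔-id)
open import Function.Construct.Symmetry using (⇔-sym)
open import Function.Construct.Composition using (_⇔-∘_)
open import Function.Properties.Inverse using (↔⇒↣)
open import Relation.Nullary using (Dec; yes; no; ¬_; does)
open import Relation.Nullary.Decidable using (_×-dec_; ¬?; dec-true; dec-false)
open import Relation.Unary using (Decidable)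
open import Relation.Binary.PropositionalEquality using (_≡_; refl; sym; trans; cong; subst)
open Relation.Binary.PropositionalEquality.≡-Reasoning

first-failure : ∀ {p} {P : ℕ → Set p} → Decidable P → ∀ {s m} → s ≤ m → P s → ¬ P m →
  ∃ λ t → s ≤ t × t < m × (∀ k → s ≤ k → k ≤ t → P k) × ¬ P (suc t)
first-failure {P = P} P? s≤m = go (≤⇒≤‴ s≤m)
  where
  go : ∀ {s m} → s ≤‴ m → P s → ¬ P m →
    ∃ λ t → s ≤ t × t < m × (∀ k → s ≤ k → k ≤ t → P k) × ¬ P (suc t)
  go ≤‴-refl Ps ¬Pm = ⊥-elim (¬Pm Ps)
  go {s} (≤‴-step s<m) Ps ¬Pm with P? (suc s)
  ... | no ¬Ps′ = s , ≤-refl , ≤‴⇒≤ s<m , (λ k s≤k k≤s → subst P (≤-antisym s≤k k≤s) Ps) , ¬Ps′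
  ... | yes Ps′ with go s<m Ps′ ¬Pm
  ...   | t , s<t , t<m , all , ¬Pt′ = t , <⇒≤ s<t , t<m , extend , ¬Pt′
    where
    extend : ∀ k → s ≤ k → k ≤ t → P k
    extend k s≤k k≤t with m≤n⇒m<n∨m≡n s≤k
    ... | inj₁ s<k = all k s<k k≤t
    ... | inj₂ refl = Ps

ups-zero : ∀ {m} (w : Vec Step m) → ups w 0 ≡ 0
ups-zero []      = refl
ups-zero (_ ∷ _) = refl

downs-zero : ∀ {m} (w : Vec Step m) → downs w 0 ≡ 0
downs-zero []      = refl
downs-zero (_ ∷ _) = refl

ups-suc : ∀ {m} (w : Vec Step m) p → ups w (suc (toℕ p)) ≡ isU (lookup w p) + ups w (toℕ p)
ups-suc (x ∷ w) zero    = cong (isU x +_) (ups-zero w)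
ups-suc (x ∷ w) (suc p) =
  trans (cong (isU x +_) (ups-suc w p)) (x∙yz≈y∙xz (isU x) (isU (lookup w p)) (ups w (toℕ p)))

downs-suc : ∀ {m} (w : Vec Step m) p → downs w (suc (toℕ p)) ≡ isD (lookup w p) + downs w (toℕ p)
downs-suc (x ∷ w) zero    = cong (isD x +_) (downs-zero w)
downs-suc (x ∷ w) (suc p) =
  trans (cong (isD x +_) (downs-suc w p)) (x∙yz≈y∙xz (isD x) (isD (lookup w p)) (downs w (toℕ p)))

module _ {m} (w : Vec Step m) (i : Fin m) where

  -- the height after the first t steps exceeds the height before step i (compared by cross-adding)
  Above : ℕ → Set
  Above t = downs w t + ups w (toℕ i) < ups w t + downs w (toℕ i)

  Above? : Decidable Above
  Above? t = downs w t + ups w (toℕ i) <? ups w t + downs w (toℕ i)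

  above-after-start : lookup w i ≡ u → Above (suc (toℕ i))
  above-after-start wi rewrite ups-suc w i | downs-suc w i | wi =
    s≤s (≤-reflexive (+-comm (downs w (toℕ i)) (ups w (toℕ i))))

  above-after-up : ∀ p → lookup w p ≡ u → Above (toℕ p) → Above (suc (toℕ p))
  above-after-up p wp above rewrite ups-suc w p | downs-suc w p | wp = m<n⇒m<1+n above

  level-after-down : ∀ p → lookup w p ≡ d → Above (toℕ p) → ¬ Above (suc (toℕ p)) →
    ups w (suc (toℕ p)) + downs w (toℕ i) ≡ downs w (suc (toℕ p)) + ups w (toℕ i)
  level-after-down p wp above ¬above′ rewrite ups-suc w p | downs-suc w p | wp =
    ≤-antisym (≮⇒≥ ¬above′) above

  matching-down-step : lookup w i ≡ u →
    ups w m + downs w (toℕ i) ≤ downs w m + ups w (toℕ i) → ∃ (Matched w i)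
  matching-down-step wi ends-low
    with first-failure Above? (toℕ<n i) (above-after-start wi) (≤⇒≯ ends-low)
  ... | t , i<t , t<m , above , ¬above′
    with fromℕ< t<m | toℕ-fromℕ< t<m
  ...   | j | refl with lookup w j in wj
  ...     | u = ⊥-elim (¬above′ (above-after-up j wj (above (toℕ j) i<t ≤-refl)))
  ...     | d = j , i<t , wi , wj , level-after-down j wj (above (toℕ j) i<t ≤-refl) ¬above′
              , λ k i<k k≤j → above (toℕ k) i<k k≤j

dyck-matched : ∀ {n w} → Dyck n w → ∀ i → lookup w i ≡ u → ∃ (Matched w i)
dyck-matched {n} {w} (ups≡n , downs≡n , prefix) i wi =
  matching-down-step w i wi ends-low
  where
  ends-low : ups w (2 * n) + downs w (toℕ i) ≤ downs w (2 * n) + ups w (toℕ i)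
  ends-low rewrite ups≡n | downs≡n = +-monoʳ-≤ n (prefix (toℕ i))

-- τ_P = σ⁻¹ τ_D σ, i.e. P is the pairing D^{σ⁻¹}
record Conjugates {m} (σ : Permutation′ m) (D P : Vec Step m) : Set where
  constructor conjugates
  field tun⇔ : ∀ k j → Tun D (σ ⟨$⟩ʳ k) (σ ⟨$⟩ʳ j) ⇔ Tun P k j

Tun-cong : ∀ {m} (w : Vec Step m) {a a′ b b′} → a ≡ a′ → b ≡ b′ → Tun w a b ⇔ Tun w a′ b′
Tun-cong w refl refl = ⇔-id _

act-conjugate : ∀ {m} (σ : Permutation′ m) {D P : Vec Step m} →
  (∀ i → lookup P i ≡ u → ∃ (Matched P i)) → Conjugates σ D P → act σ D ≡ P
act-conjugate {m} σ {D} {P} matched (conjugates conj) =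
  trans (tabulate-cong letter) (tabulate∘lookup P)
  where
  Opens : Fin m → Fin m → Set
  Opens k j = Tun D (σ ⟨$⟩ʳ k) j × ¬ InPre σ (suc (toℕ k)) j

  opens? : ∀ k → Dec (∃ (Opens k))
  opens? k = any? λ j → Tun? D (σ ⟨$⟩ʳ k) j ×-dec ¬? (InPre? σ (suc (toℕ k)) j)

  up-opens : ∀ k → lookup P k ≡ u → ∃ (Opens k)
  up-opens k Pk with matched k Pk
  ... | j , matched-kj = σ ⟨$⟩ʳ j , Equivalence.from (conj k j) (inj₁ matched-kj) , unread
    where
    unread : ¬ InPre σ (suc (toℕ k)) (σ ⟨$⟩ʳ j)
    unread (l , s≤s l≤k , σl≡σj) with Injection.injective (↔⇒↣ σ) σl≡σj
    ... | refl = <⇒≱ (proj₁ matched-kj) l≤k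

  down-closes : ∀ k → lookup P k ≡ d → ¬ ∃ (Opens k)
  down-closes k Pk (j , tun , unread)
    with Equivalence.to (conj k (σ ⟨$⟩ˡ j)) (Equivalence.from (Tun-cong D refl (inverseʳ σ)) tun)
  ... | inj₁ (_ , Pk≡u , _) = u≢d (trans (sym Pk≡u) Pk)
    where
    u≢d : ¬ u ≡ d
    u≢d ()
  ... | inj₂ (j′<k , _) = unread (σ ⟨$⟩ˡ j , s≤s (<⇒≤ j′<k) , inverseʳ σ)

  letter : ∀ k → (if does (opens? k) then u else d) ≡ lookup P k
  letter k with lookup P k in Pk
  ... | u = cong (if_then u else d) (dec-true (opens? k) (up-opens k Pk))
  ... | d = cong (if_then u else d) (dec-false (opens? k) (down-closes k Pk))

conjugates-id : ∀ {m} {e : Permutation′ m} → (∀ x → e ⟨$⟩ʳ x ≡ x) → ∀ D → Conjugates e D D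
conjugates-id e≗id D = conjugates λ k j → Tun-cong D (e≗id k) (e≗id j)

conjugates-∘ : ∀ {m} {f g h : Permutation′ m} {D P Q} → (∀ x → h ⟨$⟩ʳ x ≡ g ⟨$⟩ʳ (f ⟨$⟩ʳ x)) →
  Conjugates g D P → Conjugates f P Q → Conjugates h D Q
conjugates-∘ {f = f} {D = D} h≗g∘f (conjugates conj-g) (conjugates conj-f) = conjugates λ k j →
  conj-f k j ⇔-∘ (conj-g (f ⟨$⟩ʳ k) (f ⟨$⟩ʳ j) ⇔-∘ Tun-cong D (h≗g∘f k) (h≗g∘f j))

conjugates-inverse : ∀ {m} {h h′ : Permutation′ m} {D P} → (∀ x → h ⟨$⟩ʳ (h′ ⟨$⟩ʳ x) ≡ x) →
  Conjugates h D P → Conjugates h′ P D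
conjugates-inverse {h = h} {h′} {D} h∘h′≗id (conjugates conj) = conjugates λ k j →
  Tun-cong D (h∘h′≗id k) (h∘h′≗id j) ⇔-∘ ⇔-sym (conj (h′ ⟨$⟩ʳ k) (h′ ⟨$⟩ʳ j))

act-dyck : ∀ {n} (σ : Permutation′ (2 * n)) {D P} → Dyck n P → Conjugates σ D P → act σ D ≡ P
act-dyck {n} σ {P = P} dP = act-conjugate σ (dyck-matched {n} {P} dP)

act-∘ : ∀ {n} {f g h : Permutation′ (2 * n)} {D P Q} → (∀ x → h ⟨$⟩ʳ x ≡ g ⟨$⟩ʳ (f ⟨$⟩ʳ x)) →
  Dyck n P → Dyck n Q → Conjugates g D P → Conjugates f P Q → act h D ≡ act f (act g D)
act-∘ {n} {f} {g} {h} {D} {P} {Q} h≗g∘f dP dQ conj-g conj-f = begin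
  act h D           ≡⟨ act-dyck {n} h dQ (conjugates-∘ h≗g∘f conj-g conj-f) ⟩
  Q                 ≡⟨ act-dyck {n} f dQ conj-f ⟨
  act f P           ≡⟨ cong (act f) {act g D} (act-dyck {n} g dP conj-g) ⟨
  act f (act g D)   ∎

act-cancel : ∀ {n} {h h′ : Permutation′ (2 * n)} {D P} → (∀ x → h ⟨$⟩ʳ (h′ ⟨$⟩ʳ x) ≡ x) →
  Dyck n D → Dyck n P → Conjugates h D P → act h′ (act h D) ≡ D
act-cancel {n} {h} {h′} {D} {P} h∘h′≗id dD dP conj = begin
  act h′ (act h D)  ≡⟨ cong (act h′) {act h D} (act-dyck {n} h dP conj) ⟩
  act h′ P          ≡⟨ act-dyck {n} h′ dD (conjugates-inverse {h = h} {h′} h∘h′≗id conj) ⟩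
  D                 ∎

lemma5 : (n : ℕ) → 1 ≤ n → (H : Permutation′ (2 * n) → Set)
    → (∀ h → H h → IsCCP h)
    → (∃ λ e → H e × (∀ x → e ⟨$⟩ʳ x ≡ x))
    → (∀ h₁ h₂ → H h₁ → H h₂ → ∃ λ h → H h × (∀ x → h ⟨$⟩ʳ x ≡ h₁ ⟨$⟩ʳ (h₂ ⟨$⟩ʳ x)))
    → (∀ h → H h → ∃ λ h′ → H h′ × (∀ x → h′ ⟨$⟩ʳ (h ⟨$⟩ʳ x) ≡ x) × (∀ x → h ⟨$⟩ʳ (h′ ⟨$⟩ʳ x) ≡ x))
    → (∀ h → H h → ∀ (D : Vec Step (2 * n)) → Dyck n D → IsPathTwist n h D)
    → (∀ h → H h → ∀ (D : Vec Step (2 * n)) → Dyck n D → Dyck n (act h D))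
      × (∃ λ e → H e × (∀ D → Dyck n D → act e D ≡ D))
      × (∀ h₁ h₂ → H h₁ → H h₂ → ∃ λ h → H h × (∀ D → Dyck n D → act h D ≡ act h₁ (act h₂ D)))
      × (∀ h → H h → ∃ λ h′ → H h′ × (∀ D → Dyck n D → act h′ (act h D) ≡ D × act h (act h′ D) ≡ D))
lemma5 n _ H _ (e , He , e≗id) compose invert is-path =
  closed , (e , He , λ D dD → act-dyck {n} e dD (conjugates-id e≗id D)) , composition , inverses
  where
  conjugate : ∀ h → H h → ∀ D → Dyck n D → ∃ λ P → Dyck n P × Conjugates h D P
  conjugate h Hh D dD with invert h Hh
  ... | h′ , Hh′ , h′∘h≗id , _ with is-path h′ Hh′ D dD
  ...   | P , dP , twist = P , dP , conjugates-inverse {h = h′} {h} h′∘h≗id (conjugates twist)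

  closed : ∀ h → H h → ∀ D → Dyck n D → Dyck n (act h D)
  closed h Hh D dD = let P , dP , conj = conjugate h Hh D dD in
    subst (Dyck n) {P} {act h D} (sym (act-dyck {n} h dP conj)) dP

  composition : ∀ h₁ h₂ → H h₁ → H h₂ →
    ∃ λ h → H h × (∀ D → Dyck n D → act h D ≡ act h₁ (act h₂ D))
  composition h₁ h₂ H₁ H₂ = let h , Hh , h≗h₂∘h₁ = compose h₂ h₁ H₂ H₁ in
    h , Hh , λ D dD → let P , dP , conj₂ = conjugate h₂ H₂ D dD
                          Q , dQ , conj₁ = conjugate h₁ H₁ P dP
                      in act-∘ {n} {h₁} {h₂} {h} {D} h≗h₂∘h₁ dP dQ conj₂ conj₁

  inverses : ∀ h → H h →
    ∃ λ h′ → H h′ × (∀ D → Dyck n D → act h′ (act h D) ≡ D × act h (act h′ D) ≡ D)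
  inverses h Hh = let h′ , Hh′ , h′∘h≗id , h∘h′≗id = invert h Hh in
    h′ , Hh′ , λ D dD →
      let P , dP , conj = conjugate h Hh D dD
          P′ , dP′ , conj′ = conjugate h′ Hh′ D dD
      in act-cancel {n} {h} {h′} {D} h∘h′≗id dD dP conj
       , act-cancel {n} {h′} {h} {D} h′∘h≗id dD dP′ conj′
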